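{- Let $k,r\ge 2$ and let $n\in\mathbb N$ be divisible by $k$. Let $H$ be an $n$-vertex $r$-edge-coloured $k$-graph, let $(\mathbf j,\sigma)=((j_1,\dots,j_r),\sigma)$ be a $k$-valid pair and $\{V_1,\dots,V_r\}$ a partition of $V(H)$ such that for each $i\in[r]$ every edge of colour $i$ has type $\mathbf j+\sigma\mathbf e_i$ with respect to $(V_1,\dots,V_r)$. Suppose $\alpha_1,\dots,\alpha_r\ge 0$ satisfy $\sum_{i=1}^r\alpha_i=1$ and $|V_i|=(j_i+\sigma\alpha_i)n/k$ for every $i\in[r]$. Then every perfect matching of $H$ contains exactly $\alpha_i n/k$ edges of colour $i$, for every $i\in[r]$.
   Context: A $k$-graph has edges which are $k$-subsets of its vertex set; a perfect matching is a set of disjoint edges covering all vertices. Given a partition $\{V_1,\dots,V_r\}$ of $V(H)$, an edge $e$ has type $(t_1,\dots,t_r)$ if $|e\cap V_i|=t_i$ for all $i$; $\mathbf e_i$ is the $i$th standard unit vector of $\mathbb Z^r$. A pair $(\mathbf j,\sigma)$ with $\mathbf j\in\mathbb N_0^r$, $\sigma\in\{ -1,1\}$ is $k$-valid if $\sigma+\sum_i j_i=k$ and $j_i+\sigma\ge0$ for all $i$.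
   Formalization: The numbers $\alpha_1,\dots,\alpha_r$ with nonnegative values summing to 1 are taken in ℚ. -}

module Defs where

open import Data.Nat using (ℕ; _≟_) renaming (_+_ to _+ℕ_)
open import Data.Fin using (Fin)
open import Data.Fin.Subset using (Subset; _∩_; ⊥; ∣_∣) renaming (_∈_ to _∈ₛ_)
open import Data.List using (List; foldr; map; length; filter)
open import Data.List.Membership.Propositional using (_∈_)
open import Data.List.Relation.Unary.All using (All)
open import Data.List.Relation.Unary.Any using (Any)
open import Data.List.Relation.Unary.Unique.Propositional using (Unique)
open import Data.List.Relation.Unary.AllPairs using (AllPairs)
open import Data.Integer using (ℤ; +_; -[1+_]; 0ℤ; 1ℤ) renaming (_+_ to _+ℤ_; _*_ to _*ℤ_; _≤_ to _≤ℤ_)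
open import Data.Rational using (ℚ; 0ℚ) renaming (_+_ to _+ℚ_)
open import Data.Product using (_×_; ∃)
open import Relation.Nullary using (¬_)
open import Data.Sum using (_⊎_)
open import Data.Bool using (if_then_else_)
open import Relation.Binary.PropositionalEquality using (_≡_)
open import Relation.Nullary.Decidable using (⌊_⌋)
open import Data.Fin.Properties using () renaming (_≟_ to _≟F_)

sumℚ : List ℚ → ℚ
sumℚ = foldr _+ℚ_ 0ℚ

sumℤ : List ℤ → ℤ
sumℤ = foldr _+ℤ_ 0ℤ

unitVec : ∀ {r} → Fin r → Fin r → ℤ
unitVec i l = if ⌊ i ≟F l ⌋ then 1ℤ else 0ℤ

record ColouredGraph (k r n : ℕ) : Set where
  field
    edges   : List (Subset n)
    unique  : Unique edges
    uniform : All (λ e → ∣ e ∣ ≡ k) edges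
    colour  : Subset n → Fin r   -- only its values on edges matter

open ColouredGraph public

Disjoint : ∀ {n} → Subset n → Subset n → Set
Disjoint A B = A ∩ B ≡ ⊥

record IsPerfectMatching {k r n : ℕ} (H : ColouredGraph k r n) (M : List (Subset n)) : Set where
  field
    ⊆edges   : All (λ e → e ∈ edges H) M
    unique   : Unique M
    disjoint : AllPairs Disjoint M
    covers   : ∀ (v : Fin n) → Any (λ e → v ∈ₛ e) M

colourCount : ∀ {k r n} → ColouredGraph k r n → List (Subset n) → Fin r → ℕ
colourCount H M i = length (filter (λ e → colour H e ≟F i) M)

-- an indexed partition {V_1,…,V_r} of [n] (parts are allowed to be empty)
record IsPartition {r n : ℕ} (V : Fin r → Subset n) : Set where
  field
    disjoint : ∀ i l → ¬ (i ≡ l) → Disjoint (V i) (V l)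
    covers   : ∀ (v : Fin n) → ∃ (λ i → v ∈ₛ V i)

KValid : (k r : ℕ) → (Fin r → ℕ) → ℤ → Set
KValid k r j σ =
  (σ ≡ 1ℤ ⊎ σ ≡ Data.Integer.-1ℤ)
  × (σ +ℤ sumℤ (map (λ i → + j i) (Data.List.allFin r)) ≡ + k)
  × (∀ i → 0ℤ ≤ℤ (+ j i +ℤ σ))
  where import Data.Integer; import Data.List

ℤ→ℚ : ℤ → ℚ
ℤ→ℚ z = z Data.Rational./ 1
  where import Data.Rational

{-# OPTIONS --safe #-}
-- Count |Vᵢ| along a perfect matching M.  Every vertex lies in exactly one edge of M, so
-- |A| = Σ_{e ∈ M} |e ∩ A| for every vertex set A.  For A = V(H) this gives n = k |M|; for A = Vᵢ
-- the type condition gives |Vᵢ| = jᵢ |M| + σ mᵢ, where mᵢ is the number of edges of colour i in M.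
-- Comparing with |Vᵢ| = (jᵢ + σ αᵢ) n/k and cancelling σ = ±1 gives mᵢ = αᵢ n/k.
module Submission where

open import Defs
open import Data.Nat using (ℕ; suc; _≤_; NonZero) renaming (_+_ to _+ℕ_; _*_ to _*ℕ_)
open import Data.Nat.Properties using (+-suc)
open import Data.Nat.Divisibility using (_∣_)
open import Data.Nat.ListAction using (sum)
open import Data.Fin using (Fin)
open import Data.Fin.Properties using () renaming (_≟_ to _≟F_)
open import Data.Fin.Subset using (Subset; _∩_; _∪_; ∣_∣; ⋃; ⊤; inside; outside) renaming (⊥ to ∅; _∈_ to _∈ₛ_)
open import Data.Fin.Subset.Properties
  using (∣⊥∣≡0; ∣⊤∣≡n; ∩-zeroˡ; ∩-zeroʳ; ∪-identityˡ; ∩-identityˡ; ∩-identityʳ; ∩-distribˡ-∪; ∩-distribʳ-∪;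
         ∩-commutativeMonoid; x∈p∪q⁺; ⊆⊤; ⊆-antisym)
open import Data.Vec using (_∷_; []; tail)
open import Data.List using (List; []; _∷_; map; length; allFin)
open import Data.List.Properties using (map-∘)
open import Data.List.Membership.Propositional using (_∈_)
open import Data.List.Relation.Unary.All using (All; []; _∷_)
import Data.List.Relation.Unary.All as All
open import Data.List.Relation.Unary.Any using (Any; here; there)
open import Data.List.Relation.Unary.AllPairs using (AllPairs; []; _∷_)
import Data.List.Relation.Unary.AllPairs as AllPairs
open import Data.List.Relation.Unary.AllPairs.Properties using () renaming (map⁺ to AllPairs-map⁺)
open import Data.Integer using (ℤ; +_; 0ℤ; 1ℤ; -1ℤ) renaming (_+_ to _+ℤ_; _*_ to _*ℤ_)
open import Data.Integer.Properties using (pos-+; pos-*; *-identityʳ)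
open import Data.Integer.Tactic.RingSolver using (solve-∀)
open import Data.Rational using (ℚ; 0ℚ; 1ℚ; _/_; _+_; _*_; toℚᵘ) renaming (_≤_ to _≤ℚ_)
open import Data.Rational.Properties using (toℚᵘ-fromℚᵘ; fromℚᵘ-toℚᵘ; fromℚᵘ-cong; toℚᵘ-homo-+; toℚᵘ-homo-*; *-identityˡ; *-assoc; *-distribʳ-+; neg-injective; +-0-group; +-*-commutativeRing)
open import Data.Rational.Unnormalised using (mkℚᵘ; *≡*) renaming (_≃_ to _≃ᵘ_)
import Data.Rational.Unnormalised.Properties as ℚᵘ
open import Data.Product using (_,_)
open import Data.Sum using (_⊎_; inj₁; inj₂)
open import Algebra.Bundles using (CommutativeMonoid; CommutativeRing)
import Algebra.Properties.CommutativeSemigroup as CommutativeSemigroupProperties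
open import Algebra.Properties.Group +-0-group using () renaming (∙-cancelˡ to +-cancelˡ)
open import Algebra.Properties.Ring (CommutativeRing.ring +-*-commutativeRing) using (-1*x≈-x)
open import Relation.Nullary using (yes; no)
open import Relation.Binary.PropositionalEquality using (_≡_; refl; sym; trans; cong; cong₂; module ≡-Reasoning)
open ≡-Reasoning

private variable
  n : ℕ
  p q : Subset n
  ps : List (Subset n)

∣p∪q∣≡∣p∣+∣q∣ : Disjoint p q → ∣ p ∪ q ∣ ≡ ∣ p ∣ +ℕ ∣ q ∣
∣p∪q∣≡∣p∣+∣q∣ {p = []}          {[]}          _ = refl
∣p∪q∣≡∣p∣+∣q∣ {p = outside ∷ p} {outside ∷ q} d = ∣p∪q∣≡∣p∣+∣q∣ (cong tail d)
∣p∪q∣≡∣p∣+∣q∣ {p = inside ∷ p}  {outside ∷ q} d = cong suc (∣p∪q∣≡∣p∣+∣q∣ (cong tail d))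
∣p∪q∣≡∣p∣+∣q∣ {p = outside ∷ p} {inside ∷ q}  d =
  trans (cong suc (∣p∪q∣≡∣p∣+∣q∣ (cong tail d))) (sym (+-suc ∣ p ∣ ∣ q ∣))
∣p∪q∣≡∣p∣+∣q∣ {p = inside ∷ p}  {inside ∷ q}  ()

Disjoint-∩ : ∀ {n} {p q r s : Subset n} → Disjoint p q → Disjoint (p ∩ r) (q ∩ s)
Disjoint-∩ {n} {p} {q} {r} {s} p∩q≡∅ = begin
  (p ∩ r) ∩ (q ∩ s) ≡⟨ interchange p r q s ⟩
  (p ∩ q) ∩ (r ∩ s) ≡⟨ cong (_∩ (r ∩ s)) p∩q≡∅ ⟩
  ∅ ∩ (r ∩ s)       ≡⟨ ∩-zeroˡ (r ∩ s) ⟩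
  ∅                 ∎
  where
  open CommutativeSemigroupProperties
    (CommutativeMonoid.commutativeSemigroup (∩-commutativeMonoid n)) using (interchange)

Disjoint-⋃ : All (Disjoint p) ps → Disjoint p (⋃ ps)
Disjoint-⋃ {p = p} []                       = ∩-zeroʳ p
Disjoint-⋃ {p = p} {q ∷ ps} (p∩q≡∅ ∷ p#ps) = begin
  p ∩ (q ∪ ⋃ ps)       ≡⟨ ∩-distribˡ-∪ p q (⋃ ps) ⟩
  (p ∩ q) ∪ (p ∩ ⋃ ps) ≡⟨ cong₂ _∪_ p∩q≡∅ (Disjoint-⋃ p#ps) ⟩
  ∅ ∪ ∅                ≡⟨ ∪-identityˡ ∅ ⟩
  ∅                    ∎

∣⋃∣≡sum : ∀ {n} {ps : List (Subset n)} → AllPairs Disjoint ps → ∣ ⋃ ps ∣ ≡ sum (map ∣_∣ ps)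
∣⋃∣≡sum {n} []                      = ∣⊥∣≡0 n
∣⋃∣≡sum {ps = q ∷ ps} (q#ps ∷ #ps) =
  trans (∣p∪q∣≡∣p∣+∣q∣ (Disjoint-⋃ q#ps)) (cong (∣ q ∣ +ℕ_) (∣⋃∣≡sum #ps))

⋃-∩ : ∀ (ps : List (Subset n)) r → ⋃ ps ∩ r ≡ ⋃ (map (_∩ r) ps)
⋃-∩ []       r = ∩-zeroˡ r
⋃-∩ (q ∷ ps) r = trans (∩-distribʳ-∪ r q (⋃ ps)) (cong ((q ∩ r) ∪_) (⋃-∩ ps r))

Any∈⇒∈⋃ : ∀ {x} → Any (x ∈ₛ_) ps → x ∈ₛ ⋃ ps
Any∈⇒∈⋃ (here x∈q)   = x∈p∪q⁺ (inj₁ x∈q)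
Any∈⇒∈⋃ (there x∈ps) = x∈p∪q⁺ (inj₂ (Any∈⇒∈⋃ x∈ps))

sum-∣∩∣≡∣∣ : AllPairs Disjoint ps → (∀ x → Any (x ∈ₛ_) ps) →
             ∀ r → sum (map (λ q → ∣ q ∩ r ∣) ps) ≡ ∣ r ∣
sum-∣∩∣≡∣∣ {ps = ps} #ps covers r = begin
  sum (map (λ q → ∣ q ∩ r ∣) ps)   ≡⟨ cong sum (map-∘ ps) ⟩
  sum (map ∣_∣ (map (_∩ r) ps))    ≡⟨ sym (∣⋃∣≡sum (AllPairs-map⁺ (AllPairs.map Disjoint-∩ #ps))) ⟩
  ∣ ⋃ (map (_∩ r) ps) ∣            ≡⟨ cong ∣_∣ (sym (⋃-∩ ps r)) ⟩
  ∣ ⋃ ps ∩ r ∣                     ≡⟨ cong (λ u → ∣ u ∩ r ∣) ⋃ps≡⊤ ⟩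
  ∣ ⊤ ∩ r ∣                        ≡⟨ cong ∣_∣ (∩-identityˡ r) ⟩
  ∣ r ∣                            ∎
  where
  ⋃ps≡⊤ : ⋃ ps ≡ ⊤
  ⋃ps≡⊤ = ⊆-antisym ⊆⊤ (λ {x} _ → Any∈⇒∈⋃ (covers x))

sum-map-const : ∀ {A : Set} {f : A → ℕ} {c} {xs : List A} →
                All (λ x → f x ≡ c) xs → sum (map f xs) ≡ length xs *ℕ c
sum-map-const []           = refl
sum-map-const (fx≡c ∷ fxs) = cong₂ _+ℕ_ fx≡c (sum-map-const fxs)

module _ {k r n : ℕ} (H : ColouredGraph k r n) where

  +colourCount-∷ : ∀ e M i → + colourCount H (e ∷ M) i ≡ unitVec (colour H e) i +ℤ + colourCount H M i
  +colourCount-∷ e M i with colour H e ≟F i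
  ... | yes _ = refl
  ... | no  _ = refl

  sum-by-colour : ∀ (f : Subset n → ℕ) j σ i {M} →
    All (λ e → + f e ≡ + j +ℤ σ *ℤ unitVec (colour H e) i) M →
    + sum (map f M) ≡ + j *ℤ + length M +ℤ σ *ℤ + colourCount H M i
  sum-by-colour f j σ i {[]}    [] = zero-combination (+ j) σ
    where
    zero-combination : ∀ a b → 0ℤ ≡ a *ℤ 0ℤ +ℤ b *ℤ 0ℤ
    zero-combination = solve-∀
  sum-by-colour f j σ i {e ∷ M} (fe ∷ fM) = begin
    + (f e +ℕ sum (map f M))                     ≡⟨ pos-+ (f e) (sum (map f M)) ⟩
    + f e +ℤ + sum (map f M)                     ≡⟨ cong₂ _+ℤ_ fe (sum-by-colour f j σ i fM) ⟩
    (+ j +ℤ σ *ℤ u) +ℤ (+ j *ℤ L +ℤ σ *ℤ c)     ≡⟨ rearrange (+ j) σ u L c ⟩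
    + j *ℤ (1ℤ +ℤ L) +ℤ σ *ℤ (u +ℤ c)           ≡⟨ cong (λ t → + j *ℤ (1ℤ +ℤ L) +ℤ σ *ℤ t) (sym (+colourCount-∷ e M i)) ⟩
    + j *ℤ + length (e ∷ M) +ℤ σ *ℤ + colourCount H (e ∷ M) i ∎
    where
    u = unitVec (colour H e) i
    L = + length M
    c = + colourCount H M i
    rearrange : ∀ j σ u L c → (j +ℤ σ *ℤ u) +ℤ (j *ℤ L +ℤ σ *ℤ c) ≡ j *ℤ (1ℤ +ℤ L) +ℤ σ *ℤ (u +ℤ c)
    rearrange = solve-∀

module _ {k r n : ℕ} {H : ColouredGraph k r n} {M : List (Subset n)} (pm : IsPerfectMatching H M) where
  open IsPerfectMatching pm

  perfectMatching-size : length M *ℕ k ≡ n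
  perfectMatching-size = begin
    length M *ℕ k                 ≡⟨ sym (sum-map-const (All.map ∣e∩⊤∣≡k ⊆edges)) ⟩
    sum (map (λ e → ∣ e ∩ ⊤ ∣) M) ≡⟨ sum-∣∩∣≡∣∣ disjoint covers ⊤ ⟩
    ∣ ⊤ {n} ∣                     ≡⟨ ∣⊤∣≡n n ⟩
    n                             ∎
    where
    ∣e∩⊤∣≡k : ∀ {e} → e ∈ edges H → ∣ e ∩ ⊤ ∣ ≡ k
    ∣e∩⊤∣≡k {e} e∈H = trans (cong ∣_∣ (∩-identityʳ e)) (All.lookup (uniform H) e∈H)

  ∣∣-by-colour : ∀ A j σ i →
    (∀ e → e ∈ edges H → + ∣ e ∩ A ∣ ≡ + j +ℤ σ *ℤ unitVec (colour H e) i) →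
    + ∣ A ∣ ≡ + j *ℤ + length M +ℤ σ *ℤ + colourCount H M i
  ∣∣-by-colour A j σ i type = trans
    (cong +_ (sym (sum-∣∩∣≡∣∣ disjoint covers A)))
    (sum-by-colour H (λ e → ∣ e ∩ A ∣) j σ i (All.map (λ {e} → type e) ⊆edges))

-- ℤ→ℚ z and + n / suc d are definitionally fromℚᵘ (mkℚᵘ z 0) and fromℚᵘ (mkℚᵘ (+ n) d).
ℤ→ℚ-via-ℚᵘ : ∀ z {q} → mkℚᵘ z 0 ≃ᵘ toℚᵘ q → ℤ→ℚ z ≡ q
ℤ→ℚ-via-ℚᵘ z {q} z≃q = trans (fromℚᵘ-cong z≃q) (fromℚᵘ-toℚᵘ q)

toℚᵘ-ℤ→ℚ : ∀ z → toℚᵘ (ℤ→ℚ z) ≃ᵘ mkℚᵘ z 0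
toℚᵘ-ℤ→ℚ z = toℚᵘ-fromℚᵘ (mkℚᵘ z 0)

ℤ→ℚ-homo-+ : ∀ a b → ℤ→ℚ (a +ℤ b) ≡ ℤ→ℚ a + ℤ→ℚ b
ℤ→ℚ-homo-+ a b = ℤ→ℚ-via-ℚᵘ (a +ℤ b) (ℚᵘ.≃-trans (*≡* (over-one a b)) (ℚᵘ.≃-sym
  (ℚᵘ.≃-trans (toℚᵘ-homo-+ (ℤ→ℚ a) (ℤ→ℚ b)) (ℚᵘ.+-cong (toℚᵘ-ℤ→ℚ a) (toℚᵘ-ℤ→ℚ b)))))
  where
  over-one : ∀ a b → (a +ℤ b) *ℤ 1ℤ ≡ (a *ℤ 1ℤ +ℤ b *ℤ 1ℤ) *ℤ 1ℤ
  over-one = solve-∀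

ℤ→ℚ-homo-* : ∀ a b → ℤ→ℚ (a *ℤ b) ≡ ℤ→ℚ a * ℤ→ℚ b
ℤ→ℚ-homo-* a b = ℤ→ℚ-via-ℚᵘ (a *ℤ b) (ℚᵘ.≃-sym
  (ℚᵘ.≃-trans (toℚᵘ-homo-* (ℤ→ℚ a) (ℤ→ℚ b)) (ℚᵘ.*-cong (toℚᵘ-ℤ→ℚ a) (toℚᵘ-ℤ→ℚ b))))

ℤ→ℚ-homo-linear : ∀ a b c d → ℤ→ℚ (a *ℤ b +ℤ c *ℤ d) ≡ ℤ→ℚ a * ℤ→ℚ b + ℤ→ℚ c * ℤ→ℚ d
ℤ→ℚ-homo-linear a b c d =
  trans (ℤ→ℚ-homo-+ (a *ℤ b) (c *ℤ d)) (cong₂ _+_ (ℤ→ℚ-homo-* a b) (ℤ→ℚ-homo-* c d))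

/-≡ℤ→ℚ : ∀ k .{{_ : NonZero k}} {n} L → L *ℕ k ≡ n → + n / k ≡ ℤ→ℚ (+ L)
/-≡ℤ→ℚ (suc k-1) {n} L L*k≡n = fromℚᵘ-cong {mkℚᵘ (+ n) k-1} {mkℚᵘ (+ L) 0} (*≡* (begin
  + n *ℤ 1ℤ        ≡⟨ *-identityʳ (+ n) ⟩
  + n              ≡⟨ cong +_ (sym L*k≡n) ⟩
  + (L *ℕ suc k-1) ≡⟨ pos-* L (suc k-1) ⟩
  + L *ℤ + suc k-1 ∎))

±1-cancelˡ : ∀ {σ p q} → σ ≡ 1ℤ ⊎ σ ≡ -1ℤ → ℤ→ℚ σ * p ≡ ℤ→ℚ σ * q → p ≡ q
±1-cancelˡ {p = p} {q} (inj₁ refl) eq = trans (sym (*-identityˡ p)) (trans eq (*-identityˡ q))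
±1-cancelˡ {p = p} {q} (inj₂ refl) eq = neg-injective (trans (sym (-1*x≈-x p)) (trans eq (-1*x≈-x q)))

lemma3p1 : (k r n : ℕ) → 2 ≤ k → 2 ≤ r → {{_ : NonZero k}} → k ∣ n →
    (H : ColouredGraph k r n) →
    (j : Fin r → ℕ) (σ : ℤ) → KValid k r j σ →
    (V : Fin r → Subset n) → IsPartition V →
    (∀ (e : Subset n) → e ∈ edges H → ∀ (l : Fin r) →
      + ∣ e ∩ V l ∣ ≡ (+ j l) Data.Integer.+ (σ Data.Integer.* unitVec (colour H e) l)) →
    (α : Fin r → ℚ) → (∀ i → 0ℚ ≤ℚ α i) → sumℚ (map α (allFin r)) ≡ 1ℚ →
    (∀ i → ℤ→ℚ (+ ∣ V i ∣) ≡ (ℤ→ℚ (+ j i) + ℤ→ℚ σ * α i) * (+ n / k)) →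
    (M : List (Subset n)) → IsPerfectMatching H M →
    ∀ (i : Fin r) → ℤ→ℚ (+ colourCount H M i) ≡ α i * (+ n / k)
lemma3p1 k r n _ _ _ H j σ (σ≡±1 , _) V _ type α _ _ ∣Vᵢ∣≡ M pm i = begin
  m                ≡⟨ ±1-cancelˡ σ≡±1 (+-cancelˡ (J * N) (S * m) (S * (α i * N)) counted) ⟩
  α i * N          ≡⟨ cong (α i *_) (sym n/k≡N) ⟩
  α i * (+ n / k)  ∎
  where
  J = ℤ→ℚ (+ j i)
  S = ℤ→ℚ σ
  N = ℤ→ℚ (+ length M)
  m = ℤ→ℚ (+ colourCount H M i)

  n/k≡N : + n / k ≡ N
  n/k≡N = /-≡ℤ→ℚ k (length M) (perfectMatching-size pm)

  ∣Vᵢ∣≡jN+σm : + ∣ V i ∣ ≡ + j i *ℤ + length M +ℤ σ *ℤ + colourCount H M i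
  ∣Vᵢ∣≡jN+σm = ∣∣-by-colour pm (V i) (j i) σ i (λ e e∈H → type e e∈H i)

  counted : J * N + S * m ≡ J * N + S * (α i * N)
  counted = begin
    J * N + S * m              ≡⟨ sym (ℤ→ℚ-homo-linear (+ j i) (+ length M) σ (+ colourCount H M i)) ⟩
    ℤ→ℚ (+ j i *ℤ + length M +ℤ σ *ℤ + colourCount H M i)
                               ≡⟨ cong ℤ→ℚ (sym ∣Vᵢ∣≡jN+σm) ⟩
    ℤ→ℚ (+ ∣ V i ∣)            ≡⟨ ∣Vᵢ∣≡ i ⟩
    (J + S * α i) * (+ n / k)  ≡⟨ cong ((J + S * α i) *_) n/k≡N ⟩
    (J + S * α i) * N          ≡⟨ *-distribʳ-+ N J (S * α i) ⟩
    J * N + S * α i * N        ≡⟨ cong (λ t → J * N + t) (*-assoc S (α i) N) ⟩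
    J * N + S * (α i * N)      ∎
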